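{- Every finite extremal lattice is uniquely paired.
   Context: All lattices are finite. For a lattice $L$, $\mathcal{J}_L$ (resp. $\mathcal{M}_L$) is the set of join-irreducible (resp. meet-irreducible) elements; for $j\in\mathcal{J}_L$, $j_*$ is the unique element covered by $j$, and for $m\in\mathcal{M}_L$, $m^*$ is the unique element covering $m$. Let $\mathcal{M}_L(j)=\max\{z\in L: j_*=j\wedge z\}$ and $\mathcal{J}_L(m)=\min\{z\in L: m^*=m\vee z\}$. A pairing on $L$ is a bijection $\kappa:\mathcal{J}_L\to\mathcal{M}_L$ with $\kappa(j)\in\mathcal{M}_L(j)$ for all $j\in\mathcal{J}_L$ and $\kappa^{ -1}(m)\in\mathcal{J}_L(m)$ for all $m\in\mathcal{M}_L$; $L$ is uniquely paired if it has exactly one pairing. A lattice $L$ is extremal if it has a maximum-length chain $\hat0=x_0\lessdot x_1\lessdot\cdots\lessdot x_n=\hat1$ with $|\mathcal{J}_L|=|\mathcal{M}_L|=n$. -}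

module Defs where

open import Level using (Level; _⊔_)
open import Data.Nat using (ℕ; suc; _≤_)
open import Data.Fin using (Fin; zero; inject₁; fromℕ) renaming (suc to fsuc)
open import Data.List using (List; length)
open import Data.List.Membership.Setoid using ()
open import Data.List.Relation.Unary.All using (All)
open import Data.List.Relation.Unary.Any using (Any)
open import Data.List.Relation.Unary.AllPairs using (AllPairs)
open import Data.Product using (Σ; ∃; _×_; _,_)
open import Data.Sum using (_⊎_)
open import Relation.Nullary using (¬_)
open import Relation.Binary.Definitions using (Decidable)
open import Relation.Binary.PropositionalEquality using (_≡_)
open import Relation.Binary.Lattice.Bundles using (Lattice)

module _ {c ℓ₁ ℓ₂ : Level} (L : Lattice c ℓ₁ ℓ₂) where
  open Lattice L renaming (_≤_ to _≼_)

  _≺_ : Carrier → Carrier → Set (ℓ₁ ⊔ ℓ₂)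
  x ≺ y = x ≼ y × ¬ (x ≈ y)

  _⋖_ : Carrier → Carrier → Set (c ⊔ ℓ₁ ⊔ ℓ₂)
  x ⋖ y = x ≺ y × (∀ z → x ≺ z → ¬ (z ≺ y))

  IsBottom : Carrier → Set (c ⊔ ℓ₂)
  IsBottom x = ∀ y → x ≼ y

  IsTop : Carrier → Set (c ⊔ ℓ₂)
  IsTop x = ∀ y → y ≼ x

  record IsFiniteLattice : Set (c ⊔ ℓ₁ ⊔ ℓ₂) where
    field
      elements : List Carrier
      complete : ∀ x → Any (x ≈_) elements
      _≈?_     : Decidable _≈_
      _≼?_     : Decidable _≼_

  IsJoinIrr : Carrier → Set (c ⊔ ℓ₁ ⊔ ℓ₂)
  IsJoinIrr j = ¬ IsBottom j × (∀ x y → j ≈ (x ∨ y) → j ≈ x ⊎ j ≈ y)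

  IsMeetIrr : Carrier → Set (c ⊔ ℓ₁ ⊔ ℓ₂)
  IsMeetIrr m = ¬ IsTop m × (∀ x y → m ≈ (x ∧ y) → m ≈ x ⊎ m ≈ y)

  HasSize : ∀ {p} → (Carrier → Set p) → ℕ → Set (c ⊔ ℓ₁ ⊔ p)
  HasSize P k = Σ (List Carrier) λ xs →
      length xs ≡ k
    × All P xs
    × AllPairs (λ x y → ¬ (x ≈ y)) xs
    × (∀ x → P x → Any (x ≈_) xs)

  -- z satisfies  j_* = j ∧ z  (j_* the lower cover of j)
  LowerCond : Carrier → Carrier → Set (c ⊔ ℓ₁ ⊔ ℓ₂)
  LowerCond j z = ∀ a → a ⋖ j → a ≈ (j ∧ z)

  InM : Carrier → Carrier → Set (c ⊔ ℓ₁ ⊔ ℓ₂)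
  InM j z = LowerCond j z × (∀ w → LowerCond j w → z ≼ w → w ≈ z)

  -- z satisfies  m^* = m ∨ z  (m^* the upper cover of m)
  UpperCond : Carrier → Carrier → Set (c ⊔ ℓ₁ ⊔ ℓ₂)
  UpperCond m z = ∀ b → m ⋖ b → b ≈ (m ∨ z)

  InJ : Carrier → Carrier → Set (c ⊔ ℓ₁ ⊔ ℓ₂)
  InJ m z = UpperCond m z × (∀ w → UpperCond m w → w ≼ z → w ≈ z)

  record Pairing : Set (c ⊔ ℓ₁ ⊔ ℓ₂) where
    field
      κ        : (j : Carrier) → IsJoinIrr j → Carrier
      κ-meet   : ∀ j (p : IsJoinIrr j) → IsMeetIrr (κ j p)
      κ-cong   : ∀ j j' (p : IsJoinIrr j) (p' : IsJoinIrr j') → j ≈ j' → κ j p ≈ κ j' p'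
      κ-inj    : ∀ j j' (p : IsJoinIrr j) (p' : IsJoinIrr j') → κ j p ≈ κ j' p' → j ≈ j'
      κ-surj   : ∀ m → IsMeetIrr m → Σ Carrier λ j → Σ (IsJoinIrr j) λ p → κ j p ≈ m
      κ-inM    : ∀ j (p : IsJoinIrr j) → InM j (κ j p)
      κ⁻¹-inJ  : ∀ j (p : IsJoinIrr j) → InJ (κ j p) j

  UniquelyPaired : Set (c ⊔ ℓ₁ ⊔ ℓ₂)
  UniquelyPaired = Pairing × ((P Q : Pairing) → ∀ j (p : IsJoinIrr j) →
                     Pairing.κ P j p ≈ Pairing.κ Q j p)

  HasChainOfLength : ℕ → Set (c ⊔ ℓ₁ ⊔ ℓ₂)
  HasChainOfLength m = Σ (Fin (suc m) → Carrier) λ ys →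
                         ∀ (i : Fin m) → ys (inject₁ i) ≺ ys (fsuc i)

  Extremal : Set (c ⊔ ℓ₁ ⊔ ℓ₂)
  Extremal = Σ ℕ λ n → Σ (Fin (suc n) → Carrier) λ xs →
      IsBottom (xs zero)
    × IsTop (xs (fromℕ n))
    × (∀ (i : Fin n) → xs (inject₁ i) ⋖ xs (fsuc i))
    × (∀ m → HasChainOfLength m → m ≤ n)
    × HasSize IsJoinIrr n
    × HasSize IsMeetIrr n

-- Fix a maximal chain 0̂ = x₀ ⋖ x₁ ⋖ ⋯ ⋖ xₙ = 1̂. Label a join-irreducible j by
-- the step i at which it enters the chain (j ≤ xᵢ₊₁, j ≰ xᵢ), and a
-- meet-irreducible m by the step at which the chain leaves it (xᵢ ≤ m, xᵢ₊₁ ≰ m).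
-- Every step is the label of some join- and some meet-irreducible, so |J| = |M| = n
-- makes both labellings bijective.
-- Because xᵢ ⋖ xᵢ₊₁, the join-irreducible and the meet-irreducible labelled i
-- satisfy the pairing conditions, which gives a pairing. Conversely, every
-- pairing κ has j ≰ κ(j), so the label of κ(j) never exceeds that of j; a
-- permutation of labels that never increases one is the identity. The
-- meet-irreducible side is the join-irreducible side of the dual lattice,
-- read along the reversed chain.

module Submission where

open import Defs hiding (_≺_; _⋖_)
import Defs
open import Level using (Level; _⊔_)
open import Data.Nat as ℕ using (ℕ; zero; suc; z≤n; s≤s)
import Data.Nat.Properties as ℕ
import Data.Nat.Induction as ℕ
open import Data.Fin as Fin using (Fin; zero; suc; inject₁; fromℕ; toℕ; opposite)
import Data.Fin.Properties as Fin
import Data.Fin.Induction as Fin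
open import Data.List using ([]; _∷_; length; lookup; filter)
open import Data.List.Relation.Unary.Any as Any using (Any; here; there; any?)
open import Data.List.Relation.Unary.Any.Properties using (lookup-index)
open import Data.Product using (∃; _×_; _,_; proj₁; proj₂)
open import Data.Sum using (_⊎_; inj₁; inj₂)
open import Data.Empty using (⊥; ⊥-elim)
open import Function using (_∘_; flip)
open import Function.Definitions using (Injective)
open import Induction.WellFounded using (WellFounded; Acc; acc; module Subrelation)
import Relation.Binary.Construct.On as On
open import Relation.Binary.Core using (Rel)
open import Relation.Binary.Bundles using (Preorder)
open import Relation.Binary.Definitions using (Decidable; _Respects_; tri<; tri≈; tri>)
open import Relation.Binary.Lattice.Bundles using (Lattice)
open import Relation.Binary.Lattice.Properties.Lattice using (∧-∨-lattice)
open import Relation.Binary.PropositionalEquality as ≡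
  using (_≡_; cong; subst; subst₂)
open import Relation.Nullary using (¬_; Dec; yes; no; contradiction)
open import Relation.Nullary.Decidable using (_×-dec_; ¬?; decidable-stable)
open import Relation.Unary as U using (Pred; _⊆_)

module _ {a p q} {A : Set a} {P : Pred A p} {Q : Pred A q}
         (P? : U.Decidable P) (Q? : U.Decidable Q) (P⊆Q : P ⊆ Q) where

  filter-length-mono : ∀ xs → length (filter P? xs) ℕ.≤ length (filter Q? xs)
  filter-length-mono [] = z≤n
  filter-length-mono (x ∷ xs) with P? x | Q? x
  ... | yes _  | yes _   = s≤s (filter-length-mono xs)
  ... | yes px | no ¬qx  = contradiction (P⊆Q px) ¬qx
  ... | no _   | yes _   = ℕ.m≤n⇒m≤1+n (filter-length-mono xs)
  ... | no _   | no _    = filter-length-mono xs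

  filter-length-strict : ∀ {xs} → Any (λ x → Q x × ¬ P x) xs →
                         length (filter P? xs) ℕ.< length (filter Q? xs)
  filter-length-strict {x ∷ xs} (here (qx , ¬px)) with P? x | Q? x
  ... | yes px | _      = contradiction px ¬px
  ... | no _   | yes _  = s≤s (filter-length-mono xs)
  ... | no _   | no ¬qx = contradiction qx ¬qx
  filter-length-strict {x ∷ xs} (there found) with P? x | Q? x
  ... | yes _  | yes _  = s≤s (filter-length-strict found)
  ... | yes px | no ¬qx = contradiction (P⊆Q px) ¬qx
  ... | no _   | yes _  = ℕ.m≤n⇒m≤1+n (filter-length-strict found)
  ... | no _   | no _   = filter-length-strict found

∃-crossing : ∀ {p n} (P : Pred (Fin (suc n)) p) → U.Decidable P →
             ¬ P zero → P (fromℕ n) → ∃ λ i → ¬ P (inject₁ i) × P (suc i)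
∃-crossing {n = zero}  P P? ¬P₀ Pₙ = contradiction Pₙ ¬P₀
∃-crossing {n = suc n} P P? ¬P₀ Pₙ with P? (suc zero)
... | yes P₁ = zero , ¬P₀ , P₁
... | no ¬P₁ with i , ¬Pᵢ , Pᵢ₊₁ ← ∃-crossing (P ∘ suc) (P? ∘ suc) ¬P₁ Pₙ =
  suc i , ¬Pᵢ , Pᵢ₊₁

module _ {a ℓ₁ ℓ₂} (A : Preorder a ℓ₁ ℓ₂) where
  open Preorder A renaming (_≲_ to _≤_)

  chain-monotone : ∀ {n} (x : Fin (suc n) → Carrier) →
                   (∀ i → x (inject₁ i) ≤ x (suc i)) →
                   ∀ {i k} → toℕ i ℕ.≤ toℕ k → x i ≤ x k
  chain-monotone {zero}  x step {zero}  {zero}  _         = refl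
  chain-monotone {suc n} x step {zero}  {zero}  _         = refl
  chain-monotone {suc n} x step {zero}  {suc k} _         =
    trans (step zero) (chain-monotone (x ∘ suc) (step ∘ suc) {zero} {k} z≤n)
  chain-monotone {suc n} x step {suc i} {suc k} (s≤s i≤k) =
    chain-monotone (x ∘ suc) (step ∘ suc) i≤k

  chain-step-≤ : ∀ {n} (x : Fin (suc n) → Carrier) →
                 (∀ i → x (inject₁ i) ≤ x (suc i)) →
                 ∀ {i k} → i Fin.< k → x (suc i) ≤ x (inject₁ k)
  chain-step-≤ x step {i} {k} i<k =
    chain-monotone x step (subst (suc (toℕ i) ℕ.≤_) (≡.sym (Fin.toℕ-inject₁ k)) i<k)

opposite-inject₁ : ∀ {n} (i : Fin n) → opposite (inject₁ i) ≡ suc (opposite i)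
opposite-inject₁ {suc n} zero    = ≡.refl
opposite-inject₁ {suc n} (suc i) = cong inject₁ (opposite-inject₁ i)

opposite-fromℕ : ∀ n → opposite (fromℕ n) ≡ zero
opposite-fromℕ zero    = ≡.refl
opposite-fromℕ (suc n) = cong inject₁ (opposite-fromℕ n)

opposite-injective : ∀ {n} → Injective _≡_ _≡_ (opposite {n})
opposite-injective {x = i} {k} eq = begin
  i                       ≡⟨ Fin.opposite-involutive i ⟨
  opposite (opposite i)   ≡⟨ cong opposite eq ⟩
  opposite (opposite k)   ≡⟨ Fin.opposite-involutive k ⟩
  k                       ∎
  where open ≡.≡-Reasoning

-- If f i < i, strong induction gives f (f i) ≡ f i, hence f i ≡ i by injectivity.
injective-deflationary⇒id : ∀ {n} (f : Fin n → Fin n) → Injective _≡_ _≡_ f →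
                            (∀ i → f i Fin.≤ i) → ∀ i → f i ≡ i
injective-deflationary⇒id f f-injective f≤id i = go i (Fin.<-wellFounded i)
  where
  go : ∀ i → Acc Fin._<_ i → f i ≡ i
  go i (acc smaller) with f i Fin.≟ i
  ... | yes fi≡i = fi≡i
  ... | no fi≢i  = contradiction (f-injective (go (f i) (smaller fi<i))) fi≢i
    where fi<i = Fin.≤∧≢⇒< (f≤id i) fi≢i

module _ {c ℓ₁ ℓ₂} (L : Lattice c ℓ₁ ℓ₂) where
  open Lattice L

  HasSize⇒injection-≤ : ∀ {p m n} {P : Carrier → Set p} → HasSize L P n →
                        (f : Fin m → Carrier) → (∀ k → P (f k)) →
                        (∀ {k k′} → f k ≈ f k′ → k ≡ k′) → m ℕ.≤ n
  HasSize⇒injection-≤ (xs , ≡.refl , _ , _ , enumerated) f P-f f-injective =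
    Fin.injective⇒≤ position-injective
    where
    position : ∀ k → Any (f k ≈_) xs
    position k = enumerated (f k) (P-f k)

    position-injective : Injective _≡_ _≡_ (Any.index ∘ position)
    position-injective {k} {k′} eq = f-injective (begin
      f k                                    ≈⟨ lookup-index (position k) ⟩
      lookup xs (Any.index (position k))     ≡⟨ cong (lookup xs) eq ⟩
      lookup xs (Any.index (position k′))    ≈⟨ lookup-index (position k′) ⟨
      f k′                                   ∎)
      where open import Relation.Binary.Reasoning.Setoid setoid

  module _ {p r n} {P : Carrier → Set p} (size : HasSize L P n) (_≈?_ : Decidable _≈_)
           {Labelled : Carrier → Fin n → Set r}
           (resp : ∀ {x y i} → x ≈ y → Labelled x i → Labelled y i)
           (functional : ∀ {x i k} → Labelled x i → Labelled x k → i ≡ k)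
           (surjective : ∀ i → ∃ λ x → P x × Labelled x i) where

    private
      chosen : Fin n → Carrier
      chosen k = proj₁ (surjective k)

      chosen-labelled : ∀ k → Labelled (chosen k) k
      chosen-labelled k = proj₂ (proj₂ (surjective k))

      -- z together with the chosen elements would be n + 1 distinct elements of P.
      outlier-impossible : ∀ {z i} → P z → Labelled z i → ¬ z ≈ chosen i → ⊥
      outlier-impossible {z} {i} Pz lz z≉chosenᵢ =
        contradiction (HasSize⇒injection-≤ size f P-f f-injective) ℕ.1+n≰n
        where
        f : Fin (suc n) → Carrier
        f zero    = z
        f (suc k) = chosen k

        P-f : ∀ k → P (f k)
        P-f zero    = Pz
        P-f (suc k) = proj₁ (proj₂ (surjective k))

        z-not-chosen : ∀ {k} → ¬ z ≈ chosen k
        z-not-chosen {k} z≈ with ≡.refl ← functional lz (resp (Eq.sym z≈) (chosen-labelled k)) =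
          z≉chosenᵢ z≈

        f-injective : ∀ {k k′} → f k ≈ f k′ → k ≡ k′
        f-injective {zero}  {zero}   _  = ≡.refl
        f-injective {zero}  {suc k′} eq = contradiction eq z-not-chosen
        f-injective {suc k} {zero}   eq = contradiction (Eq.sym eq) z-not-chosen
        f-injective {suc k} {suc k′} eq =
          cong suc (functional (resp eq (chosen-labelled k)) (chosen-labelled k′))

    labelling-injective : ∀ {x y i} → P x → P y → Labelled x i → Labelled y i → x ≈ y
    labelling-injective {x} {y} {i} Px Py lx ly with x ≈? y | x ≈? chosen i
    ... | yes x≈y | _           = x≈y
    ... | no x≉y  | yes x≈chosen =
      ⊥-elim (outlier-impossible Py ly λ y≈chosen → x≉y (Eq.trans x≈chosen (Eq.sym y≈chosen)))
    ... | no _    | no x≉chosen = ⊥-elim (outlier-impossible Px lx x≉chosen)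

module _ {c ℓ₁ ℓ₂} (L : Lattice c ℓ₁ ℓ₂) where
  open Lattice L

  ⋖-dual : ∀ {x y} → Defs._⋖_ L x y → Defs._⋖_ (∧-∨-lattice L) y x
  ⋖-dual ((x≤y , x≉y) , nothing-between) =
    (x≤y , x≉y ∘ Eq.sym) ,
    λ z (z≤y , y≉z) (x≤z , z≉x) → nothing-between z (x≤z , z≉x ∘ Eq.sym) (z≤y , y≉z ∘ Eq.sym)

  dual-finite : IsFiniteLattice L → IsFiniteLattice (∧-∨-lattice L)
  dual-finite fin = record
    { elements = elements ; complete = complete ; _≈?_ = _≈?_ ; _≼?_ = flip _≼?_ }
    where open IsFiniteLattice fin

module _ {c ℓ₁ ℓ₂} (L : Lattice c ℓ₁ ℓ₂) where

  dual-InM⇒InJ : ∀ {m z} → InM (∧-∨-lattice L) m z → InJ L m z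
  dual-InM⇒InJ (lower , minimal) =
    (λ b m⋖b → lower b (⋖-dual L m⋖b)) ,
    (λ w upper w≤z → minimal w (λ a a⋖m → upper a (⋖-dual (∧-∨-lattice L) a⋖m)) w≤z)

module FiniteLattice {c ℓ₁ ℓ₂} (L : Lattice c ℓ₁ ℓ₂) (fin : IsFiniteLattice L) where
  open Lattice L
  open IsFiniteLattice fin
  open import Relation.Binary.Properties.Poset poset using (_<_; <-respˡ-≈; <-respʳ-≈; <⇒≱)

  _⋖_ : Rel Carrier (c ⊔ ℓ₁ ⊔ ℓ₂)
  _⋖_ = Defs._⋖_ L

  _<?_ : Decidable _<_
  x <? y = (x ≼? y) ×-dec ¬? (x ≈? y)

  ∃? : ∀ {p} {P : Pred Carrier p} → P Respects _≈_ → U.Decidable P → Dec (∃ P)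
  ∃? resp P? with any? P? elements
  ... | yes found = yes (Any.satisfied found)
  ... | no none   = no λ (x , Px) → none (Any.map (λ x≈e → resp x≈e Px) (complete x))

  height : Carrier → ℕ
  height x = length (filter (_≼? x) elements)

  height-strict : ∀ {x y} → x < y → height x ℕ.< height y
  height-strict {x} {y} (x≤y , x≉y) =
    filter-length-strict (_≼? x) (_≼? y) (λ e≤x → trans e≤x x≤y)
      (Any.map (λ y≈e → reflexive (Eq.sym y≈e) ,
                        λ e≤x → x≉y (antisym x≤y (trans (reflexive y≈e) e≤x)))
               (complete y))

  <-wellFounded : WellFounded _<_
  <-wellFounded = Subrelation.wellFounded height-strict (On.wellFounded height ℕ.<-wellFounded)

  -- A minimal element of { e ≤ y ∣ e ≰ b } is join-irreducible.
  ∃-joinIrr-≤-≰ : ∀ {y b} → ¬ y ≤ b → ∃ λ j → IsJoinIrr L j × j ≤ y × ¬ j ≤ b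
  ∃-joinIrr-≤-≰ {y} {b} = go y (<-wellFounded y)
    where
    go : ∀ y → Acc _<_ y → ¬ y ≤ b → ∃ λ j → IsJoinIrr L j × j ≤ y × ¬ j ≤ b
    go y (acc smaller) y≰b
      with ∃? (λ e≈e′ (e<y , e≰b) → <-respˡ-≈ e≈e′ e<y , e≰b ∘ ≤-respˡ-≈ (Eq.sym e≈e′))
              (λ e → (e <? y) ×-dec ¬? (e ≼? b))
    ... | yes (e , e<y , e≰b) with j , irr , j≤e , j≰b ← go e (smaller e<y) e≰b =
      j , irr , trans j≤e (proj₁ e<y) , j≰b
    ... | no none = y , ((λ bottom → y≰b (bottom b)) , irreducible) , refl , y≰b
      where
      below-b : ∀ {u} → u < y → u ≤ b
      below-b {u} u<y = decidable-stable (u ≼? b) (λ u≰b → none (u , u<y , u≰b))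

      irreducible : ∀ u v → y ≈ u ∨ v → y ≈ u ⊎ y ≈ v
      irreducible u v y≈u∨v with y ≈? u | y ≈? v
      ... | yes y≈u | _       = inj₁ y≈u
      ... | no _    | yes y≈v = inj₂ y≈v
      ... | no y≉u  | no y≉v  = contradiction
        (trans (reflexive y≈u∨v)
               (∨-least (below-b (≤-respʳ-≈ (Eq.sym y≈u∨v) (x≤x∨y u v) , y≉u ∘ Eq.sym))
                        (below-b (≤-respʳ-≈ (Eq.sym y≈u∨v) (y≤x∨y u v) , y≉v ∘ Eq.sym))))
        y≰b

  ∃-upperCover : ∀ {a c} → a < c → ∃ (a ⋖_)
  ∃-upperCover {a} {c} = go c (<-wellFounded c)
    where
    go : ∀ c → Acc _<_ c → a < c → ∃ (a ⋖_)
    go c (acc smaller) a<c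
      with ∃? (λ e≈e′ (a<e , e<c) → <-respʳ-≈ e≈e′ a<e , <-respˡ-≈ e≈e′ e<c)
              (λ e → (a <? e) ×-dec (e <? c))
    ... | yes (e , a<e , e<c) = go e (smaller e<c) a<e
    ... | no none             = c , a<c , λ z a<z z<c → none (z , a<z , z<c)

  ⋖-between : ∀ {a b z} → a ⋖ b → a ≤ z → z ≤ b → z ≈ a ⊎ z ≈ b
  ⋖-between {a} {b} {z} (_ , nothing-between) a≤z z≤b with z ≈? a | z ≈? b
  ... | yes z≈a | _       = inj₁ z≈a
  ... | no _    | yes z≈b = inj₂ z≈b
  ... | no z≉a  | no z≉b  = contradiction (z≤b , z≉b) (nothing-between z (a≤z , z≉a ∘ Eq.sym))

record MaximalChain {c ℓ₁ ℓ₂} (L : Lattice c ℓ₁ ℓ₂) (n : ℕ) : Set (c ⊔ ℓ₁ ⊔ ℓ₂) where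
  field
    point  : Fin (suc n) → Lattice.Carrier L
    bottom : IsBottom L (point zero)
    top    : IsTop L (point (fromℕ n))
    covers : ∀ i → Defs._⋖_ L (point (inject₁ i)) (point (suc i))

module _ {c ℓ₁ ℓ₂} {L : Lattice c ℓ₁ ℓ₂} {n : ℕ} (C : MaximalChain L n) where
  open MaximalChain C

  reverse : MaximalChain (∧-∨-lattice L) n
  reverse = record
    { point  = point ∘ opposite
    ; bottom = top
    ; top    = subst (IsBottom L ∘ point) (≡.sym (opposite-fromℕ n)) bottom
    ; covers = λ i → subst (λ k → Defs._⋖_ (∧-∨-lattice L) (point k) (point (opposite (suc i))))
                           (≡.sym (opposite-inject₁ i)) (⋖-dual L (covers (opposite i)))
    }

  reverse-inject₁-opposite : ∀ i → MaximalChain.point reverse (inject₁ (opposite i)) ≡ point (suc i)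
  reverse-inject₁-opposite i =
    cong point (≡.trans (opposite-inject₁ (opposite i)) (cong suc (Fin.opposite-involutive i)))

  reverse-suc-opposite : ∀ i → MaximalChain.point reverse (suc (opposite i)) ≡ point (inject₁ i)
  reverse-suc-opposite i = cong (point ∘ inject₁) (Fin.opposite-involutive i)

module ChainLabelling {c ℓ₁ ℓ₂} (L : Lattice c ℓ₁ ℓ₂) (fin : IsFiniteLattice L)
                      {n : ℕ} (C : MaximalChain L n) where
  open Lattice L
  open IsFiniteLattice fin
  open MaximalChain C
  open FiniteLattice L fin
  open import Relation.Binary.Properties.Poset poset using (_<_; <⇒≱)

  Label : Carrier → Fin n → Set ℓ₂
  Label x i = x ≤ point (suc i) × ¬ x ≤ point (inject₁ i)

  label-resp : ∀ {x y i} → x ≈ y → Label x i → Label y i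
  label-resp x≈y (x≤ , x≰) = ≤-respˡ-≈ x≈y x≤ , x≰ ∘ ≤-respˡ-≈ (Eq.sym x≈y)

  label-exists : ∀ {x} → ¬ IsBottom L x → ∃ (Label x)
  label-exists {x} x≠⊥
    with i , x≰ , x≤ ← ∃-crossing (λ k → x ≤ point k) (λ k → x ≼? point k)
                                  (λ x≤⊥ → x≠⊥ (λ y → trans x≤⊥ (bottom y))) (top x) =
    i , x≤ , x≰

  labelled-≤-later : ∀ {x i k} → Label x i → i Fin.< k → x ≤ point (inject₁ k)
  labelled-≤-later (x≤ , _) i<k =
    trans x≤ (chain-step-≤ preorder point (λ i → proj₁ (proj₁ (covers i))) i<k)

  label-unique : ∀ {x i k} → Label x i → Label x k → i ≡ k
  label-unique {i = i} {k} lᵢ lₖ with Fin.<-cmp i k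
  ... | tri< i<k _ _ = contradiction (labelled-≤-later lᵢ i<k) (proj₂ lₖ)
  ... | tri≈ _ i≡k _ = i≡k
  ... | tri> _ _ k<i = contradiction (labelled-≤-later lₖ k<i) (proj₂ lᵢ)

  labelled-joinIrr : ∀ i → ∃ λ j → IsJoinIrr L j × Label j i
  labelled-joinIrr i = ∃-joinIrr-≤-≰ (<⇒≱ (proj₁ (covers i)))

  module _ (size : HasSize L (IsJoinIrr L) n) where

    labelled-joinIrr-unique : ∀ {j j′ i} → IsJoinIrr L j → IsJoinIrr L j′ →
                              Label j i → Label j′ i → j ≈ j′
    labelled-joinIrr-unique = labelling-injective L size _≈?_ label-resp label-unique labelled-joinIrr

    below-labelled-joinIrr : ∀ {j a i} → IsJoinIrr L j → Label j i → a < j → a ≤ point (inject₁ i)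
    below-labelled-joinIrr {j} {a} {i} irr lj a<j =
      decidable-stable (a ≼? point (inject₁ i)) λ a≰ →
        let j′ , irr′ , j′≤a , j′≰ = ∃-joinIrr-≤-≰ a≰
            j′≈j = labelled-joinIrr-unique irr′ irr
                     (trans j′≤a (trans (proj₁ a<j) (proj₁ lj)) , j′≰) lj
        in <⇒≱ a<j (≤-respˡ-≈ j′≈j j′≤a)

module Extremal {c ℓ₁ ℓ₂} (L : Lattice c ℓ₁ ℓ₂) (fin : IsFiniteLattice L) {n : ℕ}
                (C : MaximalChain L n)
                (sizeJ : HasSize L (IsJoinIrr L) n) (sizeM : HasSize L (IsMeetIrr L) n) where
  open Lattice L
  open MaximalChain C
  open FiniteLattice L fin using (_⋖_; ⋖-between)
  open import Relation.Binary.Properties.Poset poset using (_<_; <⇒≉)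

  L′ : Lattice c ℓ₁ ℓ₂
  L′ = ∧-∨-lattice L

  module L′ = FiniteLattice L′ (dual-finite L fin)
  module J = ChainLabelling L fin C
  module M = ChainLabelling L′ (dual-finite L fin) (reverse C)
  open J public using (Label)

  LabelM : Carrier → Fin n → Set ℓ₂
  LabelM m k = point (inject₁ k) ≤ m × ¬ point (suc k) ≤ m

  LabelM⇒dual : ∀ {m k} → LabelM m k → M.Label m (opposite k)
  LabelM⇒dual {m} {k} = subst₂ (λ u v → u ≤ m × ¬ v ≤ m)
    (≡.sym (reverse-suc-opposite C k)) (≡.sym (reverse-inject₁-opposite C k))

  dual⇒LabelM : ∀ {m k} → M.Label m (opposite k) → LabelM m k
  dual⇒LabelM {m} {k} = subst₂ (λ u v → u ≤ m × ¬ v ≤ m)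
    (reverse-suc-opposite C k) (reverse-inject₁-opposite C k)

  labelM-resp : ∀ {m m′ k} → m ≈ m′ → LabelM m k → LabelM m′ k
  labelM-resp m≈m′ = dual⇒LabelM ∘ M.label-resp m≈m′ ∘ LabelM⇒dual

  labelM-exists : ∀ {m} → IsMeetIrr L m → ∃ (LabelM m)
  labelM-exists {m} irr with i , lᵢ ← M.label-exists (proj₁ irr) =
    opposite i , dual⇒LabelM (subst (M.Label m) (≡.sym (Fin.opposite-involutive i)) lᵢ)

  labelM-unique : ∀ {m k k′} → LabelM m k → LabelM m k′ → k ≡ k′
  labelM-unique lₖ lₖ′ = opposite-injective (M.label-unique (LabelM⇒dual lₖ) (LabelM⇒dual lₖ′))

  labelled-meetIrr : ∀ k → ∃ λ m → IsMeetIrr L m × LabelM m k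
  labelled-meetIrr k with m , irr , lm ← M.labelled-joinIrr (opposite k) = m , irr , dual⇒LabelM lm

  labelled-meetIrr-unique : ∀ {m m′ k} → IsMeetIrr L m → IsMeetIrr L m′ →
                            LabelM m k → LabelM m′ k → m ≈ m′
  labelled-meetIrr-unique irr irr′ lm lm′ =
    M.labelled-joinIrr-unique sizeM irr irr′ (LabelM⇒dual lm) (LabelM⇒dual lm′)

  ∃-lowerCover : ∀ {j} → ¬ IsBottom L j → ∃ (_⋖ j)
  ∃-lowerCover {j} j≠⊥
    with a , j⋖a ← L′.∃-upperCover (bottom j , λ j≈⊥ → j≠⊥ (λ y → ≤-respˡ-≈ (Eq.sym j≈⊥) (bottom y))) =
    a , ⋖-dual L′ j⋖a

  lowerCond⇒≰ : ∀ {j z} → IsJoinIrr L j → LowerCond L j z → ¬ j ≤ z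
  lowerCond⇒≰ {j} {z} irr lower j≤z with a , a⋖j ← ∃-lowerCover (proj₁ irr) =
    <⇒≉ (proj₁ a⋖j) (Eq.trans (lower a a⋖j) (antisym (x∧y≤x j z) (∧-greatest refl j≤z)))

  -- xᵢ ⋖ xᵢ₊₁ forces xᵢ ∨ j ≈ xᵢ₊₁, which j ≤ m would push below m.
  equally-labelled-≰ : ∀ {j m i} → Label j i → LabelM m i → ¬ j ≤ m
  equally-labelled-≰ {j} {m} {i} (j≤ , j≰) (≤m , ≰m) j≤m
    with ⋖-between (covers i) (x≤x∨y _ j) (∨-least (proj₁ (proj₁ (covers i))) j≤)
  ... | inj₁ ∨≈ = j≰ (≤-respʳ-≈ ∨≈ (y≤x∨y _ j))
  ... | inj₂ ∨≈ = ≰m (≤-respˡ-≈ ∨≈ (∨-least ≤m j≤m))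

  label-<⇒≤ : ∀ {j m i k} → Label j i → LabelM m k → i Fin.< k → j ≤ m
  label-<⇒≤ lj lm i<k = trans (J.labelled-≤-later lj i<k) (proj₁ lm)

  equally-labelled-InM : ∀ {j m i} → IsJoinIrr L j → IsMeetIrr L m →
                         Label j i → LabelM m i → InM L j m
  equally-labelled-InM {j} {m} {i} irr irrM lj lm = lower , maximal
    where
    lower : LowerCond L j m
    lower a a⋖j
      with ⋖-between a⋖j (∧-greatest (proj₁ (proj₁ a⋖j))
                                     (trans (J.below-labelled-joinIrr sizeJ irr lj (proj₁ a⋖j)) (proj₁ lm)))
                         (x∧y≤x j m)
    ... | inj₁ j∧m≈a = Eq.sym j∧m≈a
    ... | inj₂ j∧m≈j = contradiction (≤-respˡ-≈ j∧m≈j (x∧y≤y j m)) (equally-labelled-≰ lj lm)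

    maximal : ∀ w → LowerCond L j w → m ≤ w → w ≈ m
    maximal w lowerW m≤w =
      let m′ , irr′ , w≤m′ , ≰m′ = L′.∃-joinIrr-≤-≰ (lowerCond⇒≰ irr lowerW ∘ trans (proj₁ lj))
          m≈m′ = labelled-meetIrr-unique irrM irr′ lm (trans (proj₁ lm) (trans m≤w w≤m′) , ≰m′)
      in antisym (≤-respʳ-≈ (Eq.sym m≈m′) w≤m′) m≤w

module ExtremalPairing {c ℓ₁ ℓ₂} (L : Lattice c ℓ₁ ℓ₂) (fin : IsFiniteLattice L) {n : ℕ}
                       (C : MaximalChain L n)
                       (sizeJ : HasSize L (IsJoinIrr L) n) (sizeM : HasSize L (IsMeetIrr L) n) where
  open Lattice L
  open Extremal L fin C sizeJ sizeM
  module E′ = Extremal (∧-∨-lattice L) (dual-finite L fin) (reverse C) sizeM sizeJ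

  Label⇒dual : ∀ {j i} → Label j i → E′.LabelM j (opposite i)
  Label⇒dual {j} {i} = subst₂ (λ u v → j ≤ u × ¬ j ≤ v)
    (≡.sym (reverse-inject₁-opposite C i)) (≡.sym (reverse-suc-opposite C i))

  equally-labelled-InJ : ∀ {j m i} → IsJoinIrr L j → IsMeetIrr L m →
                         Label j i → LabelM m i → InJ L m j
  equally-labelled-InJ irr irrM lj lm =
    dual-InM⇒InJ L (E′.equally-labelled-InM irrM irr (LabelM⇒dual lm) (Label⇒dual lj))

  label-of : ∀ {j} → IsJoinIrr L j → ∃ (Label j)
  label-of irr = J.label-exists (proj₁ irr)

  PreservesLabels : (∀ j → IsJoinIrr L j → Carrier) → Set (c ⊔ ℓ₁ ⊔ ℓ₂)
  PreservesLabels κ = ∀ {j i} (irr : IsJoinIrr L j) → Label j i → LabelM (κ j irr) i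

  preservesLabels⇒pairing : (κ : ∀ j → IsJoinIrr L j → Carrier) →
                            (∀ j irr → IsMeetIrr L (κ j irr)) → PreservesLabels κ → Pairing L
  preservesLabels⇒pairing κ meet preserves = record
    { κ       = κ
    ; κ-meet  = meet
    ; κ-cong  = λ j j′ irr irr′ j≈j′ → let _ , lj = label-of irr in
        labelled-meetIrr-unique (meet j irr) (meet j′ irr′)
          (preserves irr lj) (preserves irr′ (J.label-resp j≈j′ lj))
    ; κ-inj   = λ j j′ irr irr′ κj≈κj′ → let _ , lj = label-of irr ; _ , lj′ = label-of irr′ in
        J.labelled-joinIrr-unique sizeJ irr irr′ lj
          (subst (Label j′) (labelM-unique (preserves irr′ lj′) (labelM-resp κj≈κj′ (preserves irr lj))) lj′)
    ; κ-surj  = λ m irrM → let k , lm = labelM-exists irrM ; j , irr , lj = J.labelled-joinIrr k in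
        j , irr , labelled-meetIrr-unique (meet j irr) irrM (preserves irr lj) lm
    ; κ-inM   = λ j irr → let _ , lj = label-of irr in
        equally-labelled-InM irr (meet j irr) lj (preserves irr lj)
    ; κ⁻¹-inJ = λ j irr → let _ , lj = label-of irr in
        equally-labelled-InJ irr (meet j irr) lj (preserves irr lj)
    }

  κ₀ : ∀ j → IsJoinIrr L j → Carrier
  κ₀ j irr = proj₁ (labelled-meetIrr (proj₁ (label-of irr)))

  κ₀-meetIrr : ∀ j irr → IsMeetIrr L (κ₀ j irr)
  κ₀-meetIrr j irr = proj₁ (proj₂ (labelled-meetIrr (proj₁ (label-of irr))))

  κ₀-preservesLabels : PreservesLabels κ₀
  κ₀-preservesLabels irr lj =
    subst (LabelM _) (J.label-unique (proj₂ (label-of irr)) lj)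
          (proj₂ (proj₂ (labelled-meetIrr (proj₁ (label-of irr)))))

  -- σ permutes the labels and never raises one (j ≰ κ j), so it is the identity.
  pairing-preservesLabels : (P : Pairing L) → PreservesLabels (Pairing.κ P)
  pairing-preservesLabels P {j} {i} irr lj =
    labelM-resp (Eq.sym κj≈κrepᵢ)
      (subst (LabelM _) (injective-deflationary⇒id σ σ-injective σ-deflationary i) (σ-labels i))
    where
    open Pairing P

    rep : Fin n → Carrier
    rep k = proj₁ (J.labelled-joinIrr k)

    rep-irr : ∀ k → IsJoinIrr L (rep k)
    rep-irr k = proj₁ (proj₂ (J.labelled-joinIrr k))

    rep-label : ∀ k → Label (rep k) k
    rep-label k = proj₂ (proj₂ (J.labelled-joinIrr k))

    σ : Fin n → Fin n
    σ k = proj₁ (labelM-exists (κ-meet (rep k) (rep-irr k)))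

    σ-labels : ∀ k → LabelM (κ (rep k) (rep-irr k)) (σ k)
    σ-labels k = proj₂ (labelM-exists (κ-meet (rep k) (rep-irr k)))

    σ-injective : Injective _≡_ _≡_ σ
    σ-injective {k} {k′} σk≡σk′ =
      J.label-unique (J.label-resp repₖ≈repₖ′ (rep-label k)) (rep-label k′)
      where
      repₖ≈repₖ′ = κ-inj _ _ _ _ (labelled-meetIrr-unique (κ-meet _ _) (κ-meet _ _)
                                    (subst (LabelM _) σk≡σk′ (σ-labels k)) (σ-labels k′))

    σ-deflationary : ∀ k → σ k Fin.≤ k
    σ-deflationary k = ℕ.≮⇒≥ λ k<σk →
      lowerCond⇒≰ (rep-irr k) (proj₁ (κ-inM _ _)) (label-<⇒≤ (rep-label k) (σ-labels k) k<σk)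

    κj≈κrepᵢ : κ j irr ≈ κ (rep i) (rep-irr i)
    κj≈κrepᵢ = κ-cong _ _ _ _ (J.labelled-joinIrr-unique sizeJ irr (rep-irr i) lj (rep-label i))

  uniquelyPaired : UniquelyPaired L
  uniquelyPaired =
    preservesLabels⇒pairing κ₀ κ₀-meetIrr κ₀-preservesLabels ,
    λ P Q j irr → let _ , lj = label-of irr in
      labelled-meetIrr-unique (Pairing.κ-meet P j irr) (Pairing.κ-meet Q j irr)
        (pairing-preservesLabels P irr lj) (pairing-preservesLabels Q irr lj)

proposition3p9 : ∀ {c ℓ₁ ℓ₂ : Level} (L : Lattice c ℓ₁ ℓ₂) →
    IsFiniteLattice L → Extremal L → UniquelyPaired L
proposition3p9 L fin (n , point , bottom , top , covers , _ , sizeJ , sizeM) =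
  ExtremalPairing.uniquelyPaired L fin chain sizeJ sizeM
  where
  chain : MaximalChain L n
  chain = record { point = point ; bottom = bottom ; top = top ; covers = covers }
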